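{- Let $P_1\in\mathcal{C}(G_n)$ and $P_2\in\mathcal{S}(P_1)$ and let $\mathrm{char}(P_1)=C_1$ and $\mathrm{char}(P_2)=C_2$. Let $1\leq k \leq n+1$. Then $$\mathrm{char}(P_1\,\mathrm{stack}_k^1\, P_2) = \{T^k \cup \{k\} : T \in C_1\cap C_2\}\cup\{\emptyset\}.$$
   Context: Let $Q_n=\{1,\dots,n\}$ be a set of $n$ yes/no questions. An outcome on a set $S\subseteq Q_n$ is an element of $\{0,1\}^{|S|}$, and $X_S$ denotes the set of all outcomes on $S$. A preference matrix on $Q_n$ is a $2^n\times n$ 0-1 matrix whose rows are the $2^n$ outcomes on $Q_n$, each appearing exactly once, ordered from most to least preferred. For a nonempty proper subset $S\subset Q_n$ and outcome $x$ on $Q_n-S$, $P^{[Q_n-S,x]}$ is the submatrix of $P$ formed by the columns in $S$ and the rows whose outcome on $Q_n-S$ is $x$ (in order). $S$ is separable with respect to $P$ if $P^{[Q_n-S,x]}=P^{[Q_n-S,y]}$ for all $x,y\in X_{Q_n-S}$; $\emptyset$ and $Q_n$ are always separable. The character $\mathrm{char}(P)$ is the set of all subsets of $Q_n$ separable with respect to $P$. $\mathcal{C}(G_n)$ is the set of preference matrices generated by Hamiltonian paths in the $n$-dimensional hypercube graph $G_n$ with Gray code labeling, i.e. preference matrices in which consecutive rows differ in exactly one entry. For $A\in\mathcal{C}(G_n)$, $\mathcal{S}(A)$ is the set of $B\in\mathcal{C}(G_n)$ whose first row equals the last row of $A$. For $B\in\mathcal{S}(A)$ and $k\in\{1,\dots,n+1\}$,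 $A\,\mathrm{stack}_k^1\,B$ is the $2^{n+1}\times(n+1)$ matrix obtained by placing $A$ above $B$ and inserting a new column in position $k$ (shifting later columns right) whose first $2^n$ entries are $1$ and last $2^n$ entries are $0$. For $T\subseteq Q_n$, $T^k=\{q\in T : q<k\}\cup\{q+1 : q\in T \text{ and } q \geq k\}$. -}

module Defs where

open import Data.Bool using (Bool; true; false; if_then_else_)
open import Data.Bool.Properties using () renaming (_≟_ to _≟B_)
open import Data.Nat using (ℕ; zero; suc; _+_; _^_)
open import Data.Fin using (Fin)
open import Data.Vec using (Vec; []; _∷_; insertAt)
open import Data.Vec.Properties using (≡-dec)
open import Data.List using (List; []; _∷_; length; map; filter; head; last; _++_)
open import Data.List.Properties using () renaming (≡-dec to ≡-decL)
open import Data.List.Relation.Unary.Linked using (Linked)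
open import Data.Fin.Subset using (Subset; ∁; ∣_∣)
open import Data.Product using (_×_)
open import Relation.Binary.PropositionalEquality using (_≡_)

-- An outcome on Q_n = {1..n}: a 0-1 vector of length n (true = 1).
-- Question q ∈ Q_n corresponds to index q-1 : Fin n.
Outcome : ℕ → Set
Outcome n = Vec Bool n

diffCount : ∀ {n} → Outcome n → Outcome n → ℕ
diffCount []       []       = 0
diffCount (a ∷ as) (b ∷ bs) = (if Data.Bool._xor_ a b then 1 else 0) + diffCount as bs
  where import Data.Bool

-- A preference matrix on Q_n: its rows, listed from most to least preferred,
-- with 2^n rows in which every outcome on Q_n appears exactly once.
record PrefMatrix (n : ℕ) : Set where
  field
    rows    : List (Outcome n)
    nrows   : length rows ≡ 2 ^ n
    exactly : ∀ (x : Outcome n) → length (filter (λ r → ≡-dec _≟B_ r x) rows) ≡ 1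
open PrefMatrix public

-- C(G_n): preference matrices whose consecutive rows differ in exactly one entry
-- (Hamiltonian paths in the hypercube with Gray code labelling).
InCG : ∀ {n} → PrefMatrix n → Set
InCG P = Linked (λ a b → diffCount a b ≡ 1) (rows P)

InS : ∀ {n} → PrefMatrix n → PrefMatrix n → Set
InS A B = InCG B × head (rows B) ≡ last (rows A)

restrict : ∀ {n} → Subset n → Outcome n → List Bool
restrict []            []       = []
restrict (true  ∷ s)   (a ∷ as) = a ∷ restrict s as
restrict (false ∷ s)   (a ∷ as) = restrict s as

-- P^{[Q_n - S, x]} for an outcome x on Q_n - S (given as a list of entries
-- in increasing question order): rows (in order) whose restriction to Q_n - S
-- is x, restricted to the columns in S.
subMatrix : ∀ {n} → List (Outcome n) → Subset n → List Bool → List (List Bool)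
subMatrix rs S x = map (restrict S) (filter (λ r → ≡-decL _≟B_ (restrict (∁ S) r) x) rs)

-- X_{Q_n - S}: outcomes on Q_n - S are the 0-1 lists of length |Q_n - S|.
OutcomeOn : ∀ {n} → Subset n → List Bool → Set
OutcomeOn S x = length x ≡ ∣ S ∣

-- S separable w.r.t. the matrix with the given rows.
-- (For S = ∅ and S = Q_n this condition holds automatically.)
Separable : ∀ {n} → List (Outcome n) → Subset n → Set
Separable rs S = ∀ (x y : List Bool) → OutcomeOn (∁ S) x → OutcomeOn (∁ S) y →
                 subMatrix rs S x ≡ subMatrix rs S y

Char : ∀ {n} → List (Outcome n) → Subset n → Set
Char rs S = Separable rs S

-- A stack_k^1 B; k : Fin (suc n) represents column position toℕ k + 1 ∈ {1..n+1}.
stack : ∀ {n} → Fin (suc n) → PrefMatrix n → PrefMatrix n → List (Outcome (suc n))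
stack k A B = map (λ r → insertAt r k true) (rows A) ++ map (λ r → insertAt r k false) (rows B)

-- T^k : shift elements ≥ k up by one (new position k not included).
shiftAt : ∀ {n} → Fin (suc n) → Subset n → Subset (suc n)
shiftAt k T = insertAt T k false

-- Split U by whether it contains the new column k.  If it does, outcomes off U leave column k
-- free, so each submatrix of the stack is that of P₁ stacked over that of P₂, the two blocks
-- being told apart by column k; hence U is separable iff its trace T is separable for both.
-- If it does not, fixing column k to 1 or 0 selects the submatrices of P₁ or P₂, which must
-- therefore coincide.  Let r be the last row of P₁ = first row of P₂ and take the outcome of r
-- off T: the submatrix of P₂ begins with r and that of P₁ ends with r, so the latter begins
-- with r as well and, r occurring once in P₁, consists of r alone.  That is impossible when
-- T ≠ ∅, since flipping an entry of r inside T gives another row with the same outcome off T.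
module Submission where

open import Defs
open import Level using (Level)
open import Data.Bool using (Bool; true; false; not; if_then_else_)
open import Data.Bool.Properties using (not-¬) renaming (_≟_ to _≟B_)
open import Data.Nat using (ℕ; zero; suc; _≤_; _+_; s≤s)
open import Data.Nat.Properties using (+-monoˡ-≤; suc-injective; module ≤-Reasoning)
open import Data.Fin using (Fin; zero; suc)
open import Data.Fin.Subset using (Subset; ⊥; _∪_; ⁅_⁆; ∁; ∣_∣)
open import Data.Fin.Subset.Properties using (∪-identityʳ)
open import Data.Vec using ([]; _∷_; insertAt; removeAt; lookup; replicate)
open import Data.Vec.Properties using (≡-dec; map-insertAt; insertAt-removeAt)
import Data.Vec.Properties as Vec
open import Data.List using (List; []; _∷_; [_]; length; map; filter; head; last; _++_; _∷ʳ_)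
open import Data.List.Properties
  using (∷-injective; ∷-injectiveˡ; ∷-injectiveʳ; map-injective; map-++; map-id; filter-++; filter-accept;
         filter-none; filter-some; filter-≐; length-++; ++-identityʳ)
  renaming (≡-dec to ≡-decL)
open import Data.List.Reverse using (reverseView; []; _∶_∶ʳ_)
open import Data.List.Membership.Propositional using (_∈_)
open import Data.List.Membership.Propositional.Properties using (∈-filter⁺; ∈-filter⁻; ∈-++⁻)
open import Data.List.Relation.Unary.All using (universal)
open import Data.List.Relation.Unary.All.Properties using (map⁺)
open import Data.List.Relation.Unary.Any using (here)
import Data.List.Relation.Unary.Any as Any
open import Data.Maybe using (just)
open import Data.Product using (_×_; ∃-syntax; _,_; proj₁; proj₂)
import Data.Product as Product
open import Data.Sum using (_⊎_; inj₁; inj₂)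
open import Function using (_∘_; id)
open import Function.Bundles using (_⇔_; mk⇔; Equivalence)
open import Relation.Binary.Definitions using (DecidableEquality)
open import Relation.Binary.PropositionalEquality
  using (_≡_; _≢_; refl; sym; trans; cong; cong₂; subst; module ≡-Reasoning)
open import Relation.Nullary using (¬_; yes; no; contradiction)
open import Relation.Nullary.Decidable using (decidable-stable)
open import Relation.Unary using (Decidable)

private
  variable
    a : Level
    A : Set a
    m n : ℕ

insertAtℕ : ℕ → A → List A → List A
insertAtℕ zero    c l       = c ∷ l
insertAtℕ (suc j) c []      = c ∷ []
insertAtℕ (suc j) c (x ∷ l) = x ∷ insertAtℕ j c l

length-insertAtℕ : ∀ j (c : A) l → length (insertAtℕ j c l) ≡ suc (length l)
length-insertAtℕ zero    c l       = refl
length-insertAtℕ (suc j) c []      = refl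
length-insertAtℕ (suc j) c (x ∷ l) = cong suc (length-insertAtℕ j c l)

insertAtℕ≢[] : ∀ j (c : A) l → insertAtℕ j c l ≢ []
insertAtℕ≢[] zero    c l       ()
insertAtℕ≢[] (suc j) c []      ()
insertAtℕ≢[] (suc j) c (x ∷ l) ()

insertAtℕ-injective : ∀ j {c c' : A} {l l'} → insertAtℕ j c l ≡ insertAtℕ j c' l' → c ≡ c' × l ≡ l'
insertAtℕ-injective zero                        refl = refl , refl
insertAtℕ-injective (suc j) {l = []}    {[]}     refl = refl , refl
insertAtℕ-injective (suc j) {l = []}    {_ ∷ l'} e    = contradiction (∷-injectiveʳ e) (insertAtℕ≢[] j _ l' ∘ sym)
insertAtℕ-injective (suc j) {l = _ ∷ l} {[]}     e    = contradiction (∷-injectiveʳ e) (insertAtℕ≢[] j _ l)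
insertAtℕ-injective (suc j) {l = x ∷ l} {_ ∷ l'} e    with refl , e′ ← ∷-injective e =
  Product.map₂ (cong (x ∷_)) (insertAtℕ-injective j e′)

insertAtℕ-split : ∀ j (x : List A) → length x ≡ suc m →
                  ∃[ c ] ∃[ x₀ ] (x ≡ insertAtℕ j c x₀ × length x₀ ≡ m)
insertAtℕ-split zero    (c ∷ x)     refl = c , x , refl , refl
insertAtℕ-split (suc j) (c ∷ [])    refl = c , [] , refl , refl
insertAtℕ-split (suc j) (y ∷ x ∷ l) refl with c , x₀ , eq , len ← insertAtℕ-split j (x ∷ l) refl =
  c , y ∷ x₀ , cong (y ∷_) eq , cong suc len

insertAtℕ-true≢false : ∀ j {l l'} → insertAtℕ j true l ≢ insertAtℕ j false l'
insertAtℕ-true≢false j = (λ ()) ∘ proj₁ ∘ insertAtℕ-injective j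

stackLists : ℕ → List (List Bool) → List (List Bool) → List (List Bool)
stackLists j as bs = map (insertAtℕ j true) as ++ map (insertAtℕ j false) bs

stackLists-injective : ∀ j {as bs as' bs'} → stackLists j as bs ≡ stackLists j as' bs' →
                       as ≡ as' × bs ≡ bs'
stackLists-injective j {[]}    {_}     {[]}         e = refl , map-injective (proj₂ ∘ insertAtℕ-injective j) e
stackLists-injective j {[]}    {_ ∷ _} {_ ∷ _}      e = contradiction (sym (∷-injectiveˡ e)) (insertAtℕ-true≢false j)
stackLists-injective j {[]}    {[]}    {_ ∷ _}      ()
stackLists-injective j {_ ∷ _} {_}     {[]} {_ ∷ _} e = contradiction (∷-injectiveˡ e) (insertAtℕ-true≢false j)
stackLists-injective j {_ ∷ _} {_}     {[]} {[]}    ()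
stackLists-injective j {x ∷ _} {_}     {_ ∷ _}      e with refl ← proj₂ (insertAtℕ-injective j (∷-injectiveˡ e)) =
  Product.map₁ (cong (x ∷_)) (stackLists-injective j (∷-injectiveʳ e))

module _ {A : Set a} (_≟_ : DecidableEquality A) where

  ∈-of-count≡1 : ∀ {s} xs → length (filter (_≟ s) xs) ≡ 1 → s ∈ xs
  ∈-of-count≡1 {s} xs c with filter (_≟ s) xs in eq | c
  ... | y ∷ [] | refl
    with y∈xs , refl ← ∈-filter⁻ (_≟ s) {xs = xs} (subst (y ∈_) (sym eq) (here refl)) = y∈xs

  2≤count-∷ʳ : ∀ {r} xs → r ∈ xs → 2 ≤ length (filter (_≟ r) (xs ∷ʳ r))
  2≤count-∷ʳ {r} xs r∈xs = begin
    1 + 1                                                    ≤⟨ +-monoˡ-≤ 1 (filter-some (_≟ r) (Any.map sym r∈xs)) ⟩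
    length (filter (_≟ r) xs) + 1                            ≡⟨ cong (λ l → length (filter (_≟ r) xs) + length l)
                                                                     (filter-accept (_≟ r) {xs = []} refl) ⟨
    length (filter (_≟ r) xs) + length (filter (_≟ r) [ r ]) ≡⟨ sym (length-++ (filter (_≟ r) xs)) ⟩
    length (filter (_≟ r) xs ++ filter (_≟ r) [ r ])         ≡⟨ cong length (sym (filter-++ (_≟ r) xs [ r ])) ⟩
    length (filter (_≟ r) (xs ∷ʳ r))                         ∎
    where open ≤-Reasoning

last-∷ʳ : ∀ (xs : List A) x → last (xs ∷ʳ x) ≡ just x
last-∷ʳ []           x = refl
last-∷ʳ (y ∷ [])     x = refl
last-∷ʳ (y ∷ z ∷ xs) x = last-∷ʳ (z ∷ xs) x

rank : Subset n → Fin (suc n) → ℕ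
rank T           zero    = 0
rank (true ∷ T)  (suc k) = suc (rank T k)
rank (false ∷ T) (suc k) = rank T k

length-restrict : (S : Subset n) (r : Outcome n) → length (restrict S r) ≡ ∣ S ∣
length-restrict []          []      = refl
length-restrict (true ∷ S)  (x ∷ r) = cong suc (length-restrict S r)
length-restrict (false ∷ S) (x ∷ r) = length-restrict S r

∣insertAt-false∣ : ∀ (S : Subset n) k → ∣ insertAt S k false ∣ ≡ ∣ S ∣
∣insertAt-false∣ S           zero    = refl
∣insertAt-false∣ (true ∷ S)  (suc k) = cong suc (∣insertAt-false∣ S k)
∣insertAt-false∣ (false ∷ S) (suc k) = ∣insertAt-false∣ S k

∣insertAt-true∣ : ∀ (S : Subset n) k → ∣ insertAt S k true ∣ ≡ suc ∣ S ∣
∣insertAt-true∣ S           zero    = refl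
∣insertAt-true∣ (true ∷ S)  (suc k) = cong suc (∣insertAt-true∣ S k)
∣insertAt-true∣ (false ∷ S) (suc k) = ∣insertAt-true∣ S k

∁-insertAt : ∀ (S : Subset n) k b → ∁ (insertAt S k b) ≡ insertAt (∁ S) k (not b)
∁-insertAt S k b = map-insertAt not b S k

restrict-insertAt-true : ∀ (S : Subset n) k (r : Outcome n) c →
  restrict (insertAt S k true) (insertAt r k c) ≡ insertAtℕ (rank S k) c (restrict S r)
restrict-insertAt-true S           zero    r       c = refl
restrict-insertAt-true (true ∷ S)  (suc k) (x ∷ r) c = cong (x ∷_) (restrict-insertAt-true S k r c)
restrict-insertAt-true (false ∷ S) (suc k) (x ∷ r) c = restrict-insertAt-true S k r c

restrict-insertAt-false : ∀ (S : Subset n) k (r : Outcome n) c →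
  restrict (insertAt S k false) (insertAt r k c) ≡ restrict S r
restrict-insertAt-false S           zero    r       c = refl
restrict-insertAt-false (true ∷ S)  (suc k) (x ∷ r) c = cong (x ∷_) (restrict-insertAt-false S k r c)
restrict-insertAt-false (false ∷ S) (suc k) (x ∷ r) c = restrict-insertAt-false S k r c

restrict-∁-insertAt-true : ∀ (T : Subset n) k (r : Outcome n) c →
  restrict (∁ (insertAt T k true)) (insertAt r k c) ≡ restrict (∁ T) r
restrict-∁-insertAt-true T k r c rewrite ∁-insertAt T k true = restrict-insertAt-false (∁ T) k r c

restrict-∁-insertAt-false : ∀ (T : Subset n) k (r : Outcome n) c →
  restrict (∁ (insertAt T k false)) (insertAt r k c) ≡ insertAtℕ (rank (∁ T) k) c (restrict (∁ T) r)
restrict-∁-insertAt-false T k r c rewrite ∁-insertAt T k false = restrict-insertAt-true (∁ T) k r c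

restrict-surjective : (S : Subset n) (x : List Bool) → length x ≡ ∣ S ∣ → ∃[ v ] restrict S v ≡ x
restrict-surjective []          []      refl = [] , refl
restrict-surjective (true ∷ S)  (c ∷ x) e    =
  Product.map (c ∷_) (cong (c ∷_)) (restrict-surjective S x (suc-injective e))
restrict-surjective (false ∷ S) x       e    = Product.map (false ∷_) id (restrict-surjective S x e)

restrict-jointly-injective : (S : Subset n) {r s : Outcome n} →
  restrict S r ≡ restrict S s → restrict (∁ S) r ≡ restrict (∁ S) s → r ≡ s
restrict-jointly-injective []          {[]}    {[]}    _  _  = refl
restrict-jointly-injective (true ∷ S)  {_ ∷ _} {_ ∷ _} e₁ e₂ with refl , e₁′ ← ∷-injective e₁ =
  cong (_ ∷_) (restrict-jointly-injective S e₁′ e₂)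
restrict-jointly-injective (false ∷ S) {_ ∷ _} {_ ∷ _} e₁ e₂ with refl , e₂′ ← ∷-injective e₂ =
  cong (_ ∷_) (restrict-jointly-injective S e₁ e₂′)

restrict-⊥ : (r : Outcome n) → restrict ⊥ r ≡ []
restrict-⊥ []      = refl
restrict-⊥ (x ∷ r) = restrict-⊥ r

∃-differing-inside : {T : Subset n} → T ≢ ⊥ → ∀ r →
  ∃[ s ] (s ≢ r × restrict (∁ T) s ≡ restrict (∁ T) r)
∃-differing-inside {T = []}        T≢⊥ []      = contradiction refl T≢⊥
∃-differing-inside {T = true ∷ T}  T≢⊥ (x ∷ r) = not x ∷ r , not-¬ refl ∘ sym ∘ Vec.∷-injectiveˡ , refl
∃-differing-inside {T = false ∷ T} T≢⊥ (x ∷ r)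
  with s , s≢r , e ← ∃-differing-inside (T≢⊥ ∘ cong (false ∷_)) r =
  x ∷ s , s≢r ∘ Vec.∷-injectiveʳ , cong (x ∷_) e

insertAt-⊥ : (k : Fin (suc n)) → insertAt ⊥ k false ≡ ⊥
insertAt-⊥       zero    = refl
insertAt-⊥ {suc n} (suc k) = cong (false ∷_) (insertAt-⊥ k)

insertAt-false-∪-⁅⁆ : ∀ (T : Subset n) k → insertAt T k false ∪ ⁅ k ⁆ ≡ insertAt T k true
insertAt-false-∪-⁅⁆ T           zero    = cong (true ∷_) (∪-identityʳ T)
insertAt-false-∪-⁅⁆ (true ∷ T)  (suc k) = cong (true ∷_) (insertAt-false-∪-⁅⁆ T k)
insertAt-false-∪-⁅⁆ (false ∷ T) (suc k) = cong (false ∷_) (insertAt-false-∪-⁅⁆ T k)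

EachOutcomeOnce : List (Outcome n) → Set
EachOutcomeOnce rs = ∀ x → length (filter (λ r → ≡-dec _≟B_ r x) rs) ≡ 1

matches? : (S : Subset n) (x : List Bool) → Decidable (λ r → restrict (∁ S) r ≡ x)
matches? S x r = ≡-decL _≟B_ (restrict (∁ S) r) x

SameSubMatrices : Subset n → List (Outcome n) → List (Outcome n) → Set
SameSubMatrices T xs ys = ∀ x → OutcomeOn (∁ T) x → subMatrix xs T x ≡ subMatrix ys T x

subMatrix-++ : ∀ (xs ys : List (Outcome n)) S x →
               subMatrix (xs ++ ys) S x ≡ subMatrix xs S x ++ subMatrix ys S x
subMatrix-++ xs ys S x =
  trans (cong (map (restrict S)) (filter-++ (matches? S x) xs ys))
        (map-++ (restrict S) (filter (matches? S x) xs) (filter (matches? S x) ys))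

subMatrix-map : (f : Outcome n → Outcome m) (g : List Bool → List Bool)
                (S : Subset n) (S' : Subset m) (x x' : List Bool) →
  (∀ r → (restrict (∁ S') (f r) ≡ x') ⇔ (restrict (∁ S) r ≡ x)) →
  (∀ r → restrict S' (f r) ≡ g (restrict S r)) →
  ∀ rs → subMatrix (map f rs) S' x' ≡ map g (subMatrix rs S x)
subMatrix-map f g S S' x x' match res []       = refl
subMatrix-map f g S S' x x' match res (r ∷ rs) with matches? S' x' (f r) | matches? S x r
... | yes _ | yes _ = cong₂ _∷_ (res r) (subMatrix-map f g S S' x x' match res rs)
... | yes p | no ¬q = contradiction (Equivalence.to (match r) p) ¬q
... | no ¬p | yes q = contradiction (Equivalence.from (match r) q) ¬p
... | no _  | no _  = subMatrix-map f g S S' x x' match res rs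

subMatrix-map-none : (f : Outcome n → Outcome m) (S' : Subset m) (x' : List Bool) →
  (∀ r → restrict (∁ S') (f r) ≢ x') → ∀ rs → subMatrix (map f rs) S' x' ≡ []
subMatrix-map-none f S' x' ¬match rs =
  cong (map (restrict S')) (filter-none (matches? S' x') (map⁺ (universal ¬match rs)))

subMatrix-⊥ : (rs : List (Outcome n)) → EachOutcomeOnce rs →
  ∀ x → OutcomeOn (∁ (⊥ {n})) x → subMatrix rs ⊥ x ≡ [] ∷ []
subMatrix-⊥ {n} rs once x len with v , refl ← restrict-surjective (∁ (⊥ {n})) x len =
  trans (cong (map (restrict ⊥)) same-filter) (singleton _ (once v))
  where
  same-filter : filter (matches? ⊥ x) rs ≡ filter (λ r → ≡-dec _≟B_ r v) rs
  same-filter = filter-≐ (matches? ⊥ x) (λ r → ≡-dec _≟B_ r v)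
    ((λ {r} → restrict-jointly-injective ⊥ (trans (restrict-⊥ r) (sym (restrict-⊥ v))))
    , λ { refl → refl }) rs
  singleton : ∀ (L : List (Outcome _)) → length L ≡ 1 → map (restrict ⊥) L ≡ [] ∷ []
  singleton (r ∷ []) refl = cong (_∷ []) (restrict-⊥ r)

¬SameSubMatrices-∷ʳ : (T : Subset n) → T ≢ ⊥ → ∀ init r ys →
  EachOutcomeOnce (init ∷ʳ r) → ¬ SameSubMatrices T (init ∷ʳ r) (r ∷ ys)
¬SameSubMatrices-∷ʳ {n} T T≢⊥ init r ys once same =
  contradiction (subst (2 ≤_) (once r) (2≤count-∷ʳ (≡-dec _≟B_) init (r∈init (filter P? init) refl)))
                λ { (s≤s ()) }
  where
  x : List Bool
  x = restrict (∁ T) r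

  P? : Decidable (λ s → restrict (∁ T) s ≡ x)
  P? = matches? T x

  filter-∷ʳ : filter P? (init ∷ʳ r) ≡ filter P? init ∷ʳ r
  filter-∷ʳ = trans (filter-++ P? init [ r ]) (cong (filter P? init ++_) (filter-accept P? refl))

  last≈first : map (restrict T) (filter P? init ∷ʳ r) ≡ restrict T r ∷ subMatrix ys T x
  last≈first = begin
    map (restrict T) (filter P? init ∷ʳ r)  ≡⟨ cong (map (restrict T)) filter-∷ʳ ⟨
    subMatrix (init ∷ʳ r) T x               ≡⟨ same x (length-restrict (∁ T) r) ⟩
    subMatrix (r ∷ ys) T x                  ≡⟨ cong (map (restrict T)) (filter-accept P? refl) ⟩
    restrict T r ∷ subMatrix ys T x         ∎
    where open ≡-Reasoning

  s∈filtered : ∀ {s} → s ≢ r → restrict (∁ T) s ≡ x → s ∈ filter P? init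
  s∈filtered {s} s≢r agrees
    with ∈-++⁻ (filter P? init) (subst (s ∈_) filter-∷ʳ
           (∈-filter⁺ P? (∈-of-count≡1 (≡-dec _≟B_) (init ∷ʳ r) (once s)) agrees))
  ... | inj₁ s∈ = s∈
  ... | inj₂ (here s≡r) = contradiction s≡r s≢r

  r∈init : ∀ L → filter P? init ≡ L → r ∈ init
  r∈init [] eq with s , s≢r , agrees ← ∃-differing-inside T≢⊥ r =
    contradiction (subst (s ∈_) eq (s∈filtered s≢r agrees)) λ ()
  r∈init (h ∷ t) eq = proj₁ (∈-filter⁻ P? {xs = init} (subst (r ∈_) (sym eq) (here (sym h≡r))))
    where
    h≡r : h ≡ r
    h≡r = restrict-jointly-injective T
      (∷-injectiveˡ (subst (λ L → map (restrict T) (L ∷ʳ r) ≡ restrict T r ∷ subMatrix ys T x)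
                           eq last≈first))
      (proj₂ (∈-filter⁻ P? {xs = init} (subst (h ∈_) (sym eq) (here refl))))

¬SameSubMatrices : (T : Subset n) (xs ys : List (Outcome n)) → T ≢ ⊥ →
  EachOutcomeOnce xs → head ys ≡ last xs → ¬ SameSubMatrices T xs ys
¬SameSubMatrices {n} T xs ys T≢⊥ once first≡last with reverseView xs | ys
... | [] | _ with () ← once (replicate n false)
... | init ∶ _ ∶ʳ r | []     = contradiction (trans first≡last (last-∷ʳ init r)) λ ()
... | init ∶ _ ∶ʳ r | y ∷ ys′ with refl ← trans first≡last (last-∷ʳ init r) =
  ¬SameSubMatrices-∷ʳ T T≢⊥ init r ys′ once

withColumn : Fin (suc n) → Bool → List (Outcome n) → List (Outcome (suc n))
withColumn k c = map (λ r → insertAt r k c)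

stackRows : Fin (suc n) → List (Outcome n) → List (Outcome n) → List (Outcome (suc n))
stackRows k xs ys = withColumn k true xs ++ withColumn k false ys

module _ {n} (k : Fin (suc n)) (T : Subset n) where

  subMatrix-withColumn-∈ : ∀ c x rs →
    subMatrix (withColumn k c rs) (insertAt T k true) x
      ≡ map (insertAtℕ (rank T k) c) (subMatrix rs T x)
  subMatrix-withColumn-∈ c x =
    subMatrix-map (λ r → insertAt r k c) (insertAtℕ (rank T k) c) T (insertAt T k true) x x
      (λ r → mk⇔ (trans (sym (restrict-∁-insertAt-true T k r c))) (trans (restrict-∁-insertAt-true T k r c)))
      (λ r → restrict-insertAt-true T k r c)

  subMatrix-withColumn-∉ : ∀ c x rs →
    subMatrix (withColumn k c rs) (insertAt T k false) (insertAtℕ (rank (∁ T) k) c x)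
      ≡ subMatrix rs T x
  subMatrix-withColumn-∉ c x rs = trans
    (subMatrix-map (λ r → insertAt r k c) id T (insertAt T k false) x (insertAtℕ (rank (∁ T) k) c x)
      (λ r → mk⇔ (proj₂ ∘ insertAtℕ-injective (rank (∁ T) k) ∘ trans (sym (restrict-∁-insertAt-false T k r c)))
                 (trans (restrict-∁-insertAt-false T k r c) ∘ cong (insertAtℕ (rank (∁ T) k) c)))
      (λ r → restrict-insertAt-false T k r c) rs)
    (map-id _)

  subMatrix-withColumn-∉-mismatch : ∀ {c c'} → c ≢ c' → ∀ x rs →
    subMatrix (withColumn k c rs) (insertAt T k false) (insertAtℕ (rank (∁ T) k) c' x) ≡ []
  subMatrix-withColumn-∉-mismatch {c} {c'} c≢c' x =
    subMatrix-map-none (λ r → insertAt r k c) (insertAt T k false) (insertAtℕ (rank (∁ T) k) c' x)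
      (λ r → c≢c' ∘ proj₁ ∘ insertAtℕ-injective (rank (∁ T) k) ∘ trans (sym (restrict-∁-insertAt-false T k r c)))

  subMatrix-stack-∈ : ∀ xs ys x →
    subMatrix (stackRows k xs ys) (insertAt T k true) x
      ≡ stackLists (rank T k) (subMatrix xs T x) (subMatrix ys T x)
  subMatrix-stack-∈ xs ys x =
    trans (subMatrix-++ (withColumn k true xs) (withColumn k false ys) (insertAt T k true) x)
          (cong₂ _++_ (subMatrix-withColumn-∈ true x xs) (subMatrix-withColumn-∈ false x ys))

  subMatrix-stack-∉ : ∀ xs ys c x →
    subMatrix (stackRows k xs ys) (insertAt T k false) (insertAtℕ (rank (∁ T) k) c x)
      ≡ subMatrix (if c then xs else ys) T x
  subMatrix-stack-∉ xs ys true x =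
    trans (subMatrix-++ (withColumn k true xs) (withColumn k false ys) (insertAt T k false) _)
          (trans (cong₂ _++_ (subMatrix-withColumn-∉ true x xs) (subMatrix-withColumn-∉-mismatch (λ ()) x ys))
                 (++-identityʳ _))
  subMatrix-stack-∉ xs ys false x =
    trans (subMatrix-++ (withColumn k true xs) (withColumn k false ys) (insertAt T k false) _)
          (cong₂ _++_ (subMatrix-withColumn-∉-mismatch (λ ()) x xs) (subMatrix-withColumn-∉ false x ys))

  separable-stack-∈ : ∀ xs ys →
    Separable (stackRows k xs ys) (insertAt T k true) ⇔ (Separable xs T × Separable ys T)
  separable-stack-∈ xs ys = mk⇔
    (λ sep → (λ x y lx ly → proj₁ (split sep x y lx ly)) , (λ x y lx ly → proj₂ (split sep x y lx ly)))
    (λ (sepxs , sepys) x y lx ly → begin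
      subMatrix (stackRows k xs ys) (insertAt T k true) x            ≡⟨ subMatrix-stack-∈ xs ys x ⟩
      stackLists (rank T k) (subMatrix xs T x) (subMatrix ys T x)    ≡⟨ cong₂ (stackLists (rank T k))
                                                                          (sepxs x y (trans lx ∣∁T∣) (trans ly ∣∁T∣))
                                                                          (sepys x y (trans lx ∣∁T∣) (trans ly ∣∁T∣)) ⟩
      stackLists (rank T k) (subMatrix xs T y) (subMatrix ys T y)    ≡⟨ subMatrix-stack-∈ xs ys y ⟨
      subMatrix (stackRows k xs ys) (insertAt T k true) y            ∎)
    where
    open ≡-Reasoning
    ∣∁T∣ : ∣ ∁ (insertAt T k true) ∣ ≡ ∣ ∁ T ∣
    ∣∁T∣ = trans (cong ∣_∣ (∁-insertAt T k true)) (∣insertAt-false∣ (∁ T) k)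
    split : Separable (stackRows k xs ys) (insertAt T k true) →
            ∀ x y → OutcomeOn (∁ T) x → OutcomeOn (∁ T) y →
            subMatrix xs T x ≡ subMatrix xs T y × subMatrix ys T x ≡ subMatrix ys T y
    split sep x y lx ly = stackLists-injective (rank T k) (begin
      stackLists (rank T k) (subMatrix xs T x) (subMatrix ys T x)    ≡⟨ subMatrix-stack-∈ xs ys x ⟨
      subMatrix (stackRows k xs ys) (insertAt T k true) x            ≡⟨ sep x y (trans lx (sym ∣∁T∣)) (trans ly (sym ∣∁T∣)) ⟩
      subMatrix (stackRows k xs ys) (insertAt T k true) y            ≡⟨ subMatrix-stack-∈ xs ys y ⟩
      stackLists (rank T k) (subMatrix xs T y) (subMatrix ys T y)    ∎)

  separable-stack-∉ : ∀ xs ys → EachOutcomeOnce xs → EachOutcomeOnce ys → head ys ≡ last xs →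
    Separable (stackRows k xs ys) (insertAt T k false) ⇔ T ≡ ⊥
  separable-stack-∉ xs ys once-xs once-ys first≡last = mk⇔
    (λ sep → decidable-stable (≡-dec _≟B_ T ⊥) λ T≢⊥ → ¬SameSubMatrices T xs ys T≢⊥ once-xs first≡last λ x len →
       trans (sym (subMatrix-stack-∉ xs ys true x))
             (trans (sep _ _ (lengthOf true x len) (lengthOf false x len)) (subMatrix-stack-∉ xs ys false x)))
    λ T≡⊥ x y lx ly → trans (singleRow T≡⊥ x lx) (sym (singleRow T≡⊥ y ly))
    where
    ∣∁T∣ : ∣ ∁ (insertAt T k false) ∣ ≡ suc ∣ ∁ T ∣
    ∣∁T∣ = trans (cong ∣_∣ (∁-insertAt T k false)) (∣insertAt-true∣ (∁ T) k)
    lengthOf : ∀ c x → OutcomeOn (∁ T) x →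
               OutcomeOn (∁ (insertAt T k false)) (insertAtℕ (rank (∁ T) k) c x)
    lengthOf c x len = trans (length-insertAtℕ (rank (∁ T) k) c x) (trans (cong suc len) (sym ∣∁T∣))
    singleRow : T ≡ ⊥ → ∀ x → OutcomeOn (∁ (insertAt T k false)) x →
                subMatrix (stackRows k xs ys) (insertAt T k false) x ≡ [] ∷ []
    singleRow refl x len with insertAtℕ-split (rank (∁ T) k) x (trans len ∣∁T∣)
    ... | true  , x₀ , refl , len₀ =
      trans (subMatrix-stack-∉ xs ys true x₀) (subMatrix-⊥ xs once-xs x₀ len₀)
    ... | false , x₀ , refl , len₀ =
      trans (subMatrix-stack-∉ xs ys false x₀) (subMatrix-⊥ ys once-ys x₀ len₀)

theorem4 : ∀ (n : ℕ) (P₁ P₂ : PrefMatrix n) → InCG P₁ → InS P₁ P₂ →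
    ∀ (k : Fin (suc n)) (U : Subset (suc n)) →
    Char (stack k P₁ P₂) U ⇔
      ((∃[ T ] (Char (rows P₁) T × Char (rows P₂) T × U ≡ shiftAt k T ∪ ⁅ k ⁆)) ⊎ U ≡ ⊥)
theorem4 n P₁ P₂ _ (_ , first≡last) k U =
  mk⇔ (classify (lookup U k) (removeAt U k) (insertAt-removeAt U k)) realise
  where
  M : List (Outcome (suc n))
  M = stack k P₁ P₂

  Shape : Subset (suc n) → Set
  Shape V = (∃[ T ] (Char (rows P₁) T × Char (rows P₂) T × V ≡ shiftAt k T ∪ ⁅ k ⁆)) ⊎ V ≡ ⊥

  k∈ : ∀ T → Separable M (insertAt T k true) ⇔ (Char (rows P₁) T × Char (rows P₂) T)
  k∈ T = separable-stack-∈ k T (rows P₁) (rows P₂)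

  k∉ : ∀ T → Separable M (insertAt T k false) ⇔ T ≡ ⊥
  k∉ T = separable-stack-∉ k T (rows P₁) (rows P₂) (exactly P₁) (exactly P₂) first≡last

  classify : ∀ b T → insertAt T k b ≡ U → Separable M U → Shape U
  classify true  T refl sep with sep₁ , sep₂ ← Equivalence.to (k∈ T) sep =
    inj₁ (T , sep₁ , sep₂ , sym (insertAt-false-∪-⁅⁆ T k))
  classify false T refl sep with refl ← Equivalence.to (k∉ T) sep = inj₂ (insertAt-⊥ k)

  realise : Shape U → Separable M U
  realise (inj₁ (T , sep₁ , sep₂ , refl)) =
    subst (Separable M) (sym (insertAt-false-∪-⁅⁆ T k)) (Equivalence.from (k∈ T) (sep₁ , sep₂))
  realise (inj₂ refl) = subst (Separable M) (insertAt-⊥ k) (Equivalence.from (k∉ ⊥) refl)
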